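{- For all integers $m \leq s \leq d$ and for every finite field $\mathbb{F}$, \[\mathrm{minrk}_{\mathbb{F}}(K(d,s,m)) \leq \sum_{i=0}^{s-m}\binom{d}{i}.\] Moreover, this bound can be achieved by a symmetric matrix, i.e., there is a symmetric matrix over $\mathbb{F}$ representing $K(d,s,m)$ whose rank is at most $\sum_{i=0}^{s-m}\binom{d}{i}$.
   Context: For integers $m \leq s \leq d$, the generalized Kneser graph $K(d,s,m)$ has as vertices all $s$-subsets of $[d]$, two sets $A,B$ being adjacent if $|A\cap B| < m$. For a graph $G$ on vertex set $V$ with $|V|=n$ and a field $\mathbb{F}$, an $n\times n$ matrix $M$ over $\mathbb{F}$ indexed by $V$ represents $G$ if $M_{v,v}\neq 0$ for all $v$ and $M_{u,v}=0$ for all distinct non-adjacent $u,v$; $\mathrm{minrk}_{\mathbb{F}}(G)$ is the minimum rank over $\mathbb{F}$ of a matrix representing $G$. -}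

module Defs where

open import Level using (Level; _⊔_)
open import Data.Nat using (ℕ; zero; suc; _+_; _<_; _≤_)
open import Data.Nat.Combinatorics using (_C_)
open import Data.Fin using (Fin)
open import Data.Fin.Subset using (Subset; _∩_; ∣_∣)
open import Data.Product using (Σ; Σ-syntax; ∃; ∃-syntax; _×_; _,_; proj₁)
open import Relation.Binary.PropositionalEquality using (_≡_; _≢_)
open import Relation.Nullary using (¬_)
open import Algebra.Bundles using (CommutativeRing)
import Algebra.Definitions.RawMonoid as RM

record IsField {c ℓ : Level} (R : CommutativeRing c ℓ) : Set (c ⊔ ℓ) where
  open CommutativeRing R
  field
    0≉1     : ¬ (0# ≈ 1#)
    inverse : ∀ x → ¬ (x ≈ 0#) → Σ[ y ∈ Carrier ] (x * y ≈ 1#)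

IsFiniteRing : {c ℓ : Level} (R : CommutativeRing c ℓ) → Set (c ⊔ ℓ)
IsFiniteRing R = Σ[ n ∈ ℕ ] Σ[ f ∈ (Fin n → Carrier) ] (∀ x → ∃[ i ] (f i ≈ x))
  where open CommutativeRing R

KVertex : ℕ → ℕ → Set
KVertex d s = Σ[ A ∈ Subset d ] (∣ A ∣ ≡ s)

KAdj : {d s : ℕ} (m : ℕ) → KVertex d s → KVertex d s → Set
KAdj m (A , _) (B , _) = ∣ A ∩ B ∣ < m

module _ {c ℓ : Level} (R : CommutativeRing c ℓ) where
  open CommutativeRing R
  open RM (+-rawMonoid) using (sum)

  Represents : {V : Set} (Adj : V → V → Set) (M : V → V → Carrier) → Set ℓ
  Represents {V} Adj M =
    (∀ v → ¬ (M v v ≈ 0#)) ×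
    (∀ u v → u ≢ v → ¬ Adj u v → M u v ≈ 0#)

  -- rank M ≤ r : M factors as A · B with inner dimension r
  -- (over a field this is equivalent to the usual rank being ≤ r).
  RankAtMost : {V : Set} (M : V → V → Carrier) (r : ℕ) → Set (c ⊔ ℓ)
  RankAtMost {V} M r =
    Σ[ A ∈ (V → Fin r → Carrier) ] Σ[ B ∈ (Fin r → V → Carrier) ]
      (∀ u v → M u v ≈ sum (λ k → A u k * B k v))

  Symmetric : {V : Set} (M : V → V → Carrier) → Set ℓ
  Symmetric M = ∀ u v → M u v ≈ M v u

  MinrkAtMost : {V : Set} (Adj : V → V → Set) (r : ℕ) → Set (c ⊔ ℓ)
  MinrkAtMost {V} Adj r = Σ[ M ∈ (V → V → Carrier) ] (Represents Adj M × RankAtMost M r)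

binomSum : ℕ → ℕ → ℕ
binomSum d zero    = d C 0
binomSum d (suc k) = binomSum d k + d C suc k

{-# OPTIONS --safe #-}

-- With k = s ∸ m, let M(A, B) = ∑_{i ≤ k} (-1)ⁱ C(|A ∖ B|, i), which equals (-1)ᵏ C(|A ∖ B| - 1, k)
-- when A ⊈ B. So M(A, A) = 1, while M(A, B) = 0 for distinct non-adjacent s-sets, because then
-- 1 ≤ |A ∖ B| = s - |A ∩ B| ≤ k; and M is symmetric as |A ∖ B| = |B ∖ A| for sets of equal size.
-- Grouping by the sets I ⊆ A ∖ B of size i gives
--   M(A, B) = ∑_{I ⊆ [d], |I| ≤ k} (-1)^|I| [I ⊆ A] [I ∩ B = ∅],
-- a product of matrices of inner dimension ∑_{i ≤ k} C(d, i). The factorisation is built by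
-- induction on d: splitting off the first point, M_{k+1}(a ∷ A, b ∷ B) = M_{k+1}(A, B) - [a] [¬ b] M_k(A, B),
-- and rank is subadditive, matching Pascal's rule for ∑_{i ≤ k} C(d, i).
module Submission where

open import Defs
open import Level using (Level)
open import Data.Nat using (ℕ; zero; suc; _≤_; _<_; _∸_; z≤n; s≤s)
open import Data.Product using (Σ-syntax; _×_; _,_; proj₁)
open import Algebra.Bundles using (CommutativeRing; Monoid)

import Data.Nat as ℕ
import Data.Nat.Properties as ℕ
open import Data.Nat.Combinatorics using (_C_; nCk+nC[k+1]≡[n+1]C[k+1])
open import Data.Bool using (Bool; true; false; not)
open import Data.Fin using (splitAt)
open import Data.Fin.Subset using (Subset; inside; outside; _∩_; _─_; ∣_∣)
open import Data.Fin.Subset.Properties using (∩-comm)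
open import Data.Sum using (inj₁; inj₂)
open import Data.Sum.Properties using ([,]-map)
open import Data.Vec as Vec using ([]; _∷_)
open import Data.Vec.Functional using (Vector; _++_; head; tail; zipWith)
open import Function using (_∘_)
open import Relation.Binary.PropositionalEquality as ≡ using (_≡_; _≢_; _≗_)
open import Relation.Nullary using (¬_)

zipWith-++ : ∀ {a b c} {A : Set a} {B : Set b} {C : Set c} {m n}
             (f : A → B → C) (xs : Vector A m) (ys : Vector A n) xs′ ys′ →
             zipWith f (xs ++ ys) (xs′ ++ ys′) ≗ zipWith f xs xs′ ++ zipWith f ys ys′
zipWith-++ {m = m} f xs ys xs′ ys′ i with splitAt m i
... | inj₁ _ = ≡.refl
... | inj₂ _ = ≡.refl

module _ {a ℓ} (M : Monoid a ℓ) where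
  open Monoid M
  open import Algebra.Properties.Monoid.Sum M using (sum; sum-cong-≗)
  open import Relation.Binary.Reasoning.Setoid setoid

  sum-++ : ∀ {m n} (xs : Vector Carrier m) (ys : Vector Carrier n) →
           sum (xs ++ ys) ≈ sum xs ∙ sum ys
  sum-++ {zero}  xs ys = sym (identityˡ (sum ys))
  sum-++ {suc m} xs ys = begin
    head xs ∙ sum (tail (xs ++ ys))     ≡⟨ ≡.cong (head xs ∙_) (sum-cong-≗ (λ i → [,]-map (splitAt m i))) ⟩
    head xs ∙ sum (tail xs ++ ys)       ≈⟨ ∙-congˡ (sum-++ (tail xs) ys) ⟩
    head xs ∙ (sum (tail xs) ∙ sum ys)  ≈⟨ sym (assoc _ _ _) ⟩
    head xs ∙ sum (tail xs) ∙ sum ys    ∎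

module RankAtMost {c ℓ : Level} (R : CommutativeRing c ℓ) where
  open CommutativeRing R
  open import Algebra.Properties.Semiring.Sum semiring
    using (sum; sum-cong-≋; sum-cong-≗; *-distribˡ-sum; *-distribʳ-sum)
  open import Relation.Binary.Reasoning.Setoid setoid

  private variable
    V W : Set
    M N : V → V → Carrier
    p q r : ℕ

  cong : (∀ u v → M u v ≈ N u v) → RankAtMost R M r → RankAtMost R N r
  cong M≈N (A , B , M≈AB) = A , B , λ u v → trans (sym (M≈N u v)) (M≈AB u v)

  reindex : (φ : W → V) → RankAtMost R M r → RankAtMost R (λ u v → M (φ u) (φ v)) r
  reindex φ (A , B , M≈AB) = A ∘ φ , (λ k → B k ∘ φ) , λ u v → M≈AB (φ u) (φ v)

  scale : (f g : V → Carrier) → RankAtMost R M r → RankAtMost R (λ u v → f u * M u v * g v) r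
  scale {M = M} f g (A , B , M≈AB) = (λ u k → f u * A u k) , (λ k v → B k v * g v) , λ u v → begin
    f u * M u v * g v                          ≈⟨ *-congʳ (*-congˡ (M≈AB u v)) ⟩
    f u * sum (λ k → A u k * B k v) * g v      ≈⟨ *-congʳ (*-distribˡ-sum (f u) (λ k → A u k * B k v)) ⟩
    sum (λ k → f u * (A u k * B k v)) * g v    ≈⟨ *-distribʳ-sum (g v) (λ k → f u * (A u k * B k v)) ⟩
    sum (λ k → f u * (A u k * B k v) * g v)    ≈⟨ sum-cong-≋ (λ k → regroup (f u) (A u k) (B k v) (g v)) ⟩
    sum (λ k → f u * A u k * (B k v * g v))    ∎
    where
    regroup : ∀ w x y z → w * (x * y) * z ≈ w * x * (y * z)
    regroup w x y z = trans (*-congʳ (sym (*-assoc w x y))) (*-assoc (w * x) y z)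

  +-subadditive : RankAtMost R M p → RankAtMost R N q → RankAtMost R (λ u v → M u v + N u v) (p ℕ.+ q)
  +-subadditive {M = M} {N = N} (A₁ , B₁ , M≈AB) (A₂ , B₂ , N≈AB) =
    (λ u → A₁ u ++ A₂ u) , (λ k v → ((λ i → B₁ i v) ++ (λ i → B₂ i v)) k) , λ u v → begin
      M u v + N u v
        ≈⟨ +-cong (M≈AB u v) (N≈AB u v) ⟩
      sum (zipWith _*_ (A₁ u) (λ i → B₁ i v)) + sum (zipWith _*_ (A₂ u) (λ i → B₂ i v))
        ≈⟨ sym (sum-++ +-monoid (zipWith _*_ (A₁ u) (λ i → B₁ i v)) (zipWith _*_ (A₂ u) (λ i → B₂ i v))) ⟩
      sum (zipWith _*_ (A₁ u) (λ i → B₁ i v) ++ zipWith _*_ (A₂ u) (λ i → B₂ i v))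
        ≡⟨ sum-cong-≗ (zipWith-++ _*_ (A₁ u) (A₂ u) _ _) ⟨
      sum (zipWith _*_ (A₁ u ++ A₂ u) ((λ i → B₁ i v) ++ (λ i → B₂ i v)))
        ∎

  ones : RankAtMost R (λ (_ _ : V) → 1#) 1
  ones = (λ _ _ → 1#) , (λ _ _ → 1#) , λ _ _ → sym (trans (+-identityʳ _) (*-identityˡ 1#))

binomSum-zeroˡ : ∀ k → binomSum 0 k ≡ 1
binomSum-zeroˡ zero    = ≡.refl
binomSum-zeroˡ (suc k) = ≡.trans (ℕ.+-identityʳ (binomSum 0 k)) (binomSum-zeroˡ k)

binomSum-pascal : ∀ d k → binomSum (suc d) (suc k) ≡ binomSum d (suc k) ℕ.+ binomSum d k
binomSum-pascal d zero = begin
  1 ℕ.+ suc d C 1          ≡⟨ ≡.cong (1 ℕ.+_) (nCk+nC[k+1]≡[n+1]C[k+1] d 0) ⟨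
  1 ℕ.+ (1 ℕ.+ d C 1)      ≡⟨ ℕ.+-comm 1 (1 ℕ.+ d C 1) ⟩
  (1 ℕ.+ d C 1) ℕ.+ 1      ∎
  where open ≡.≡-Reasoning
binomSum-pascal d (suc k) = begin
  binomSum (suc d) (suc k) ℕ.+ suc d C suc (suc k)
    ≡⟨ ≡.cong₂ ℕ._+_ (binomSum-pascal d k) (≡.sym (nCk+nC[k+1]≡[n+1]C[k+1] d (suc k))) ⟩
  (binomSum d (suc k) ℕ.+ binomSum d k) ℕ.+ (d C suc k ℕ.+ d C suc (suc k))
    ≡⟨ ≡.cong ((binomSum d (suc k) ℕ.+ binomSum d k) ℕ.+_) (ℕ.+-comm (d C suc k) _) ⟩
  (binomSum d (suc k) ℕ.+ binomSum d k) ℕ.+ (d C suc (suc k) ℕ.+ d C suc k)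
    ≡⟨ interchange (binomSum d (suc k)) (binomSum d k) (d C suc (suc k)) (d C suc k) ⟩
  binomSum d (suc (suc k)) ℕ.+ binomSum d (suc k)
    ∎
  where open ≡.≡-Reasoning
        open import Algebra.Properties.CommutativeSemigroup ℕ.+-commutativeSemigroup using (interchange)

∣p∣≡∣p∩q∣+∣p─q∣ : ∀ {n} (p q : Subset n) → ∣ p ∣ ≡ ∣ p ∩ q ∣ ℕ.+ ∣ p ─ q ∣
∣p∣≡∣p∩q∣+∣p─q∣ []            []            = ≡.refl
∣p∣≡∣p∩q∣+∣p─q∣ (inside  ∷ p) (inside  ∷ q) = ≡.cong suc (∣p∣≡∣p∩q∣+∣p─q∣ p q)
∣p∣≡∣p∩q∣+∣p─q∣ (inside  ∷ p) (outside ∷ q) =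
  ≡.trans (≡.cong suc (∣p∣≡∣p∩q∣+∣p─q∣ p q)) (≡.sym (ℕ.+-suc ∣ p ∩ q ∣ ∣ p ─ q ∣))
∣p∣≡∣p∩q∣+∣p─q∣ (outside ∷ p) (inside  ∷ q) = ∣p∣≡∣p∩q∣+∣p─q∣ p q
∣p∣≡∣p∩q∣+∣p─q∣ (outside ∷ p) (outside ∷ q) = ∣p∣≡∣p∩q∣+∣p─q∣ p q

∣p─q∣≡∣p∣∸∣p∩q∣ : ∀ {n} (p q : Subset n) → ∣ p ─ q ∣ ≡ ∣ p ∣ ∸ ∣ p ∩ q ∣
∣p─q∣≡∣p∣∸∣p∩q∣ p q = ≡.trans (≡.sym (ℕ.m+n∸m≡n ∣ p ∩ q ∣ ∣ p ─ q ∣))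
                                (≡.cong (_∸ ∣ p ∩ q ∣) (≡.sym (∣p∣≡∣p∩q∣+∣p─q∣ p q)))

∣p∣≡∣q∣⇒∣p─q∣≡∣q─p∣ : ∀ {n} (p q : Subset n) → ∣ p ∣ ≡ ∣ q ∣ → ∣ p ─ q ∣ ≡ ∣ q ─ p ∣
∣p∣≡∣q∣⇒∣p─q∣≡∣q─p∣ p q ∣p∣≡∣q∣ = ℕ.+-cancelˡ-≡ ∣ p ∩ q ∣ _ _ (begin
  ∣ p ∩ q ∣ ℕ.+ ∣ p ─ q ∣   ≡⟨ ∣p∣≡∣p∩q∣+∣p─q∣ p q ⟨
  ∣ p ∣                     ≡⟨ ∣p∣≡∣q∣ ⟩
  ∣ q ∣                     ≡⟨ ∣p∣≡∣p∩q∣+∣p─q∣ q p ⟩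
  ∣ q ∩ p ∣ ℕ.+ ∣ q ─ p ∣   ≡⟨ ≡.cong (λ r → ∣ r ∣ ℕ.+ ∣ q ─ p ∣) (∩-comm q p) ⟩
  ∣ p ∩ q ∣ ℕ.+ ∣ q ─ p ∣   ∎)
  where open ≡.≡-Reasoning

∣p─p∣≡0 : ∀ {n} (p : Subset n) → ∣ p ─ p ∣ ≡ 0
∣p─p∣≡0 []            = ≡.refl
∣p─p∣≡0 (inside  ∷ p) = ∣p─p∣≡0 p
∣p─p∣≡0 (outside ∷ p) = ∣p─p∣≡0 p

∣p─q∣≡0∧∣q─p∣≡0⇒p≡q : ∀ {n} (p q : Subset n) → ∣ p ─ q ∣ ≡ 0 → ∣ q ─ p ∣ ≡ 0 → p ≡ q
∣p─q∣≡0∧∣q─p∣≡0⇒p≡q []            []            _  _  = ≡.refl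
∣p─q∣≡0∧∣q─p∣≡0⇒p≡q (inside  ∷ p) (inside  ∷ q) e₁ e₂ = ≡.cong (inside ∷_) (∣p─q∣≡0∧∣q─p∣≡0⇒p≡q p q e₁ e₂)
∣p─q∣≡0∧∣q─p∣≡0⇒p≡q (outside ∷ p) (outside ∷ q) e₁ e₂ = ≡.cong (outside ∷_) (∣p─q∣≡0∧∣q─p∣≡0⇒p≡q p q e₁ e₂)
∣p─q∣≡0∧∣q─p∣≡0⇒p≡q (inside  ∷ p) (outside ∷ q) () _
∣p─q∣≡0∧∣q─p∣≡0⇒p≡q (outside ∷ p) (inside  ∷ q) _  ()

KVertex-≡ : ∀ {d s} {u v : KVertex d s} → proj₁ u ≡ proj₁ v → u ≡ v
KVertex-≡ {u = A , ∣A∣≡s} {v = .A , ∣A∣≡s′} ≡.refl = ≡.cong (A ,_) (ℕ.≡-irrelevant ∣A∣≡s ∣A∣≡s′)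

distinct⇒0<∣─∣ : ∀ {d s} (u v : KVertex d s) → u ≢ v → 0 < ∣ proj₁ u ─ proj₁ v ∣
distinct⇒0<∣─∣ (A , ∣A∣≡s) (B , ∣B∣≡s) u≢v = ℕ.n≢0⇒n>0 λ ∣A─B∣≡0 →
  let ∣B─A∣≡0 = ≡.trans (≡.sym (∣p∣≡∣q∣⇒∣p─q∣≡∣q─p∣ A B (≡.trans ∣A∣≡s (≡.sym ∣B∣≡s)))) ∣A─B∣≡0
  in u≢v (KVertex-≡ (∣p─q∣≡0∧∣q─p∣≡0⇒p≡q A B ∣A─B∣≡0 ∣B─A∣≡0))

nonadjacent⇒∣─∣≤s∸m : ∀ {d s} m (u v : KVertex d s) → ¬ KAdj m u v → ∣ proj₁ u ─ proj₁ v ∣ ≤ s ∸ m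
nonadjacent⇒∣─∣≤s∸m {s = s} m (A , ∣A∣≡s) (B , _) ¬adj = begin
  ∣ A ─ B ∣            ≡⟨ ∣p─q∣≡∣p∣∸∣p∩q∣ A B ⟩
  ∣ A ∣ ∸ ∣ A ∩ B ∣    ≡⟨ ≡.cong (_∸ ∣ A ∩ B ∣) ∣A∣≡s ⟩
  s ∸ ∣ A ∩ B ∣        ≤⟨ ℕ.∸-monoʳ-≤ s (ℕ.≮⇒≥ ¬adj) ⟩
  s ∸ m                ∎
  where open ℕ.≤-Reasoning

module AlternatingMatrix {c ℓ : Level} (R : CommutativeRing c ℓ) where
  open CommutativeRing R
  open import Algebra.Properties.Ring ring using (-0#≈0#; -1*x≈-x)

  -- alternatingBinomialSum k n = ∑_{i ≤ k} (-1)ⁱ C(n, i), by Pascal's rule.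
  alternatingBinomialSum : ℕ → ℕ → Carrier
  alternatingBinomialSum zero    n       = 1#
  alternatingBinomialSum (suc k) zero    = 1#
  alternatingBinomialSum (suc k) (suc n) = alternatingBinomialSum (suc k) n - alternatingBinomialSum k n

  alternatingBinomialSum-vanishes : ∀ {k n} → 0 < n → n ≤ k → alternatingBinomialSum k n ≈ 0#
  alternatingBinomialSum-vanishes {suc zero}    {suc zero}    _ _           = -‿inverseʳ 1#
  alternatingBinomialSum-vanishes {suc (suc k)} {suc zero}    _ _           = -‿inverseʳ 1#
  alternatingBinomialSum-vanishes {suc k}       {suc (suc n)} _ (s≤s 1+n≤k) = begin
    alternatingBinomialSum (suc k) (suc n) - alternatingBinomialSum k (suc n)
      ≈⟨ +-cong (alternatingBinomialSum-vanishes (s≤s z≤n) (ℕ.m≤n⇒m≤1+n 1+n≤k))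
                (-‿cong (alternatingBinomialSum-vanishes (s≤s z≤n) 1+n≤k)) ⟩
    0# - 0#
      ≈⟨ +-congˡ -0#≈0# ⟩
    0# + 0#
      ≈⟨ +-identityʳ 0# ⟩
    0# ∎
    where open import Relation.Binary.Reasoning.Setoid setoid

  alternatingMatrix : ∀ {d} → ℕ → Subset d → Subset d → Carrier
  alternatingMatrix k A B = alternatingBinomialSum k ∣ A ─ B ∣

  alternatingMatrix-diagonal : ∀ {d} k (A : Subset d) → alternatingMatrix k A A ≡ 1#
  alternatingMatrix-diagonal zero    A = ≡.refl
  alternatingMatrix-diagonal (suc k) A = ≡.cong (alternatingBinomialSum (suc k)) (∣p─p∣≡0 A)

  alternatingMatrix-sym : ∀ {d} k (A B : Subset d) → ∣ A ∣ ≡ ∣ B ∣ →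
                          alternatingMatrix k A B ≡ alternatingMatrix k B A
  alternatingMatrix-sym k A B ∣A∣≡∣B∣ = ≡.cong (alternatingBinomialSum k) (∣p∣≡∣q∣⇒∣p─q∣≡∣q─p∣ A B ∣A∣≡∣B∣)

  ⟦_⟧ : Bool → Carrier
  ⟦ true  ⟧ = 1#
  ⟦ false ⟧ = 0#

  alternatingMatrix-∷ : ∀ {d} k a b (A B : Subset d) →
    alternatingMatrix (suc k) A B + - ⟦ a ⟧ * alternatingMatrix k A B * ⟦ not b ⟧
    ≈ alternatingMatrix (suc k) (a ∷ A) (b ∷ B)
  alternatingMatrix-∷ k a     true  A B = trans (+-congˡ (zeroʳ _)) (+-identityʳ _)
  alternatingMatrix-∷ k false false A B =
    trans (+-congˡ (trans (*-identityʳ _) (trans (*-congʳ -0#≈0#) (zeroˡ _)))) (+-identityʳ _)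
  alternatingMatrix-∷ k true  false A B = +-congˡ (trans (*-identityʳ _) (-1*x≈-x _))

  private module Rank = RankAtMost R

  alternatingMatrix-rank : ∀ d k → RankAtMost R (alternatingMatrix {d} k) (binomSum d k)
  alternatingMatrix-rank d       zero    = Rank.ones
  alternatingMatrix-rank zero    (suc k) =
    ≡.subst (RankAtMost R _) (≡.sym (binomSum-zeroˡ (suc k))) (Rank.cong (λ where [] [] → refl) Rank.ones)
  alternatingMatrix-rank (suc d) (suc k) =
    ≡.subst (RankAtMost R _) (≡.sym (binomSum-pascal d k))
      (Rank.cong (λ where (a ∷ A) (b ∷ B) → alternatingMatrix-∷ k a b A B)
        (Rank.+-subadditive
          (Rank.reindex Vec.tail (alternatingMatrix-rank d (suc k)))
          (Rank.scale (λ u → - ⟦ Vec.head u ⟧) (λ v → ⟦ not (Vec.head v) ⟧)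
            (Rank.reindex Vec.tail (alternatingMatrix-rank d k)))))

theorem3p2 : {c ℓ : Level} (F : CommutativeRing c ℓ) → IsField F → IsFiniteRing F →
             (m s d : ℕ) → m ≤ s → s ≤ d →
             MinrkAtMost F (KAdj {d} {s} m) (binomSum d (s ∸ m))
             × (Σ[ M ∈ (KVertex d s → KVertex d s → CommutativeRing.Carrier F) ]
                  (Represents F (KAdj {d} {s} m) M × Symmetric F M
                   × RankAtMost F M (binomSum d (s ∸ m))))
theorem3p2 F isField _ m s d _ _ = (M , represents , rank) , (M , represents , symmetric , rank)
  where
  open CommutativeRing F using (Carrier; sym; trans; reflexive)
  open AlternatingMatrix F

  M : KVertex d s → KVertex d s → Carrier
  M u v = alternatingMatrix (s ∸ m) (proj₁ u) (proj₁ v)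

  represents : Represents F (KAdj m) M
  represents =
    (λ (A , _) M≈0 → IsField.0≉1 isField (trans (sym M≈0) (reflexive (alternatingMatrix-diagonal (s ∸ m) A))))
    , λ u v u≢v ¬adj → alternatingBinomialSum-vanishes
                          (distinct⇒0<∣─∣ u v u≢v) (nonadjacent⇒∣─∣≤s∸m m u v ¬adj)

  symmetric : Symmetric F M
  symmetric (A , ∣A∣≡s) (B , ∣B∣≡s) =
    reflexive (alternatingMatrix-sym (s ∸ m) A B (≡.trans ∣A∣≡s (≡.sym ∣B∣≡s)))

  rank : RankAtMost F M (binomSum d (s ∸ m))
  rank = RankAtMost.reindex F proj₁ (alternatingMatrix-rank d (s ∸ m))
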